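{- Let $n,k$ be positive integers with $n\ge k$ and $n> 3(n-k)$. Let $C$ be any linear chord diagram with $n$ chords in which every chord has length at least $k$, and let $\beta_{n,k}(C)$ be the diagram defined below. Then $\beta_{n,k}(C)$ is a linear chord diagram with $n-1$ chords in which every chord has length at least $k-1$. Definition of $\beta_{n,k}(C)$: Let $M_{n,k}=\{k+1,\dots,2n-k\}$ and let $S_C$ be the set of chords of $C$ having neither endpoint in $M_{n,k}$. Let $c$ be the chord of $C$ whose end point is $2n-k+1$ (the point immediately after $M_{n,k}$). Repeatedly exchange the start point of $c$ with the start point of the chord of $S_C$ whose start point is the closest one to the right of the current start point of $c$ (so $c$ takes that position and that chord takes $c$'s previous start position), until no chord of $S_C$ has its start point to the right of the start point of $c$. Then delete the chord $c$ and relabel the remaining $2n-2$ points by $1,\dots,2n-2$ preserving their order. The result is $\beta_{n,k}(C)$.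
   Context: A linear chord diagram with $N$ chords is a partition of $\{1,2,\dots,2N\}$ into blocks of size two, called chords. For a chord $c=\{s_c,e_c\}$ with $s_c<e_c$, $s_c$ is its start point, $e_c$ its end point, and its length is $e_c-s_c$. -}

module Defs where

open import Data.Nat using (ℕ; zero; suc; _+_; _*_; _∸_; _≤_; _<_; _≤ᵇ_; _<ᵇ_; _≡ᵇ_)
open import Data.Bool using (Bool; true; false; if_then_else_; _∧_; not)
open import Data.Maybe using (Maybe; just; nothing)
open import Data.Product using (_×_; _,_)
open import Relation.Binary.PropositionalEquality using (_≡_; _≢_)

-- A linear chord diagram with N chords on the points 1,…,2N is encoded by its
-- fixed-point-free involution p : each point i is sent to the other endpoint
-- p i of its chord.  Values of p outside 1,…,2N are irrelevant.
IsChordDiagram : ℕ → (ℕ → ℕ) → Set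
IsChordDiagram N p =
  ∀ i → 1 ≤ i → i ≤ 2 * N →
    (1 ≤ p i) × (p i ≤ 2 * N) × (p i ≢ i) × (p (p i) ≡ i)

AllLengthsAtLeast : ℕ → ℕ → (ℕ → ℕ) → Set
AllLengthsAtLeast N k p =
  ∀ i → 1 ≤ i → i ≤ 2 * N → i < p i → k + i ≤ p i

inM : ℕ → ℕ → ℕ → Bool
inM n k x = (k <ᵇ x) ∧ (x ≤ᵇ 2 * n ∸ k)

isSStart : ℕ → ℕ → (ℕ → ℕ) → ℕ → Bool
isSStart n k q j =
  (1 ≤ᵇ j) ∧ (j ≤ᵇ 2 * n) ∧ (j <ᵇ q j) ∧ not (inM n k j) ∧ not (inM n k (q j))

search : ℕ → (ℕ → Bool) → ℕ → Maybe ℕ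
search zero    P a = nothing
search (suc f) P a = if P a then just a else search f P (suc a)

-- chord c = {s, e} and chord d = {j, q j}: exchange the start points s and j
swapStart : (ℕ → ℕ) → ℕ → ℕ → ℕ → (ℕ → ℕ)
swapStart q e s j x =
  if x ≡ᵇ s then q j
  else if x ≡ᵇ j then e
  else if x ≡ᵇ e then j
  else if x ≡ᵇ q j then s
  else q x

-- the repeated exchange; returns the final diagram and final start point of c.
-- The start point of c strictly increases, so 2n rounds suffice.
record DiagPt : Set where
  constructor _,,_
  field
    diag : ℕ → ℕ
    pt   : ℕ

exchangeLoop : ℕ → ℕ → ℕ → ℕ → (ℕ → ℕ) → ℕ → DiagPt
exchangeLoop n k e zero     q s = q ,, s
exchangeLoop n k e (suc f)  q s with search (2 * n) (isSStart n k q) (suc s)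
... | nothing = q ,, s
... | just j  = exchangeLoop n k e f (swapStart q e s j) j

β : ℕ → ℕ → (ℕ → ℕ) → (ℕ → ℕ)
β n k C i = g (q (f i))
  where
    e : ℕ
    e = 2 * n ∸ k + 1
    res : DiagPt
    res = exchangeLoop n k e (2 * n) C (C e)
    q : ℕ → ℕ
    q = DiagPt.diag res
    sf : ℕ
    sf = DiagPt.pt res
    -- new label i ↦ old point (points sf and e deleted, order preserved)
    f : ℕ → ℕ
    f x = if x <ᵇ sf then x else if suc x <ᵇ e then suc x else x + 2
    g : ℕ → ℕ
    g x = if x <ᵇ sf then x else if x <ᵇ e then x ∸ 1 else x ∸ 2

module Submission where

-- Write e = 2n-k+1 for the point just after the window
-- M = {k+1,…,2n-k}.  Since k + e > 2n, no chord of length ≥ k starts at or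
-- after e, and the hypothesis n > 3(n-k) gives e ≤ 2k; hence the chord c
-- ending at e starts at some s ≤ k, and every chord of S starts in {1,…,k}.
--
-- The exchange loop keeps an invariant (`Exchange.Invariant`): the diagram is
-- a chord diagram, c = {s,e} with 1 ≤ s ≤ k, every other chord has length ≥ k,
-- and every chord straddling c (starting before s, ending after e) has length
-- ≥ k+1.  One exchange with the next chord {j,b} of S (a `Reconnect`ion of
-- the two chords) preserves it: a chord starting between s and j and ending
-- after e would be a chord of S before j, so whatever straddles the new moving
-- chord {j,e} already straddled {s,e}.  Finally, deleting a chord {s,e}
-- (module `Deletion`) maps a chord diagram on 2N+2 points to one on 2N points
-- and shortens every chord by the number of deleted points it covers: by at
-- most one, unless it straddles; so all lengths stay ≥ k-1.

open import Defs
open import Data.Nat using (ℕ; zero; suc; _+_; _*_; _∸_; _≤_; _<_; _<?_; _≤ᵇ_; _<ᵇ_; _≡ᵇ_; z≤n; s≤s; s≤s⁻¹)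
open import Data.Nat.Properties
open import Data.Nat.Tactic.RingSolver using (solve-∀)
open import Data.Bool using (Bool; true; false; not; T; if_then_else_)
open import Data.Bool.Properties using (T-∧)
open import Data.Unit using (tt)
open import Data.Maybe using (just; nothing)
open import Data.Product using (Σ-syntax; _×_; _,_; proj₁; proj₂)
open import Data.Sum using (_⊎_; inj₁; inj₂)
open import Data.Empty using (⊥-elim)
open import Function using (_∘_; Equivalence)
open import Relation.Nullary using (¬_; yes; no)
open import Relation.Binary.Definitions using (Tri; tri<; tri≈; tri>)
open import Relation.Binary.PropositionalEquality

open Equivalence using (to; from)
open ≤-Reasoning

true-when : ∀ {a} {A : Set a} {b : Bool} → (A → T b) → A → b ≡ true
true-when {b = true}  _        _ = refl
true-when {b = false} complete a = ⊥-elim (complete a)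

false-when : ∀ {a} {A : Set a} {b : Bool} → (T b → A) → ¬ A → b ≡ false
false-when {b = false} _     _  = refl
false-when {b = true}  sound ¬a = ⊥-elim (¬a (sound tt))

≡ᵇ-refl : ∀ m → (m ≡ᵇ m) ≡ true
≡ᵇ-refl m = true-when (≡⇒≡ᵇ m m) refl

≡ᵇ-≢ : ∀ {m n} → m ≢ n → (m ≡ᵇ n) ≡ false
≡ᵇ-≢ {m} {n} = false-when (≡ᵇ⇒≡ m n)

<ᵇ-true : ∀ {m n} → m < n → (m <ᵇ n) ≡ true
<ᵇ-true = true-when <⇒<ᵇ

<ᵇ-false : ∀ {m n} → n ≤ m → (m <ᵇ n) ≡ false
<ᵇ-false {m} {n} n≤m = false-when (<ᵇ⇒< m n) (≤⇒≯ n≤m)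

≤ᵇ-false : ∀ {m n} → n < m → (m ≤ᵇ n) ≡ false
≤ᵇ-false {m} {n} n<m = false-when (≤ᵇ⇒≤ m n) (<⇒≱ n<m)

search-first : ∀ fuel P a j → search fuel P a ≡ just j →
               T (P j) × a ≤ j × (∀ x → a ≤ x → x < j → ¬ T (P x))
search-first zero       P a j ()
search-first (suc fuel) P a j found with P a in Pa
search-first (suc fuel) P a .a refl | true =
  subst T (sym Pa) tt , ≤-refl , λ x a≤x x<a → ⊥-elim (<⇒≱ x<a a≤x)
... | false with search-first fuel P (suc a) j found
... | Pj , a<j , first = Pj , <⇒≤ a<j , earlier
  where
  earlier : ∀ x → a ≤ x → x < j → ¬ T (P x)
  earlier x a≤x x<j with m≤n⇒m<n∨m≡n a≤x
  ... | inj₁ a<x  = first x a<x x<j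
  ... | inj₂ refl = subst T Pa

module ChordDiagram {N : ℕ} {q : ℕ → ℕ} (cd : IsChordDiagram N q) where

  partner≥1 : ∀ {x} → 1 ≤ x → x ≤ 2 * N → 1 ≤ q x
  partner≥1 x≥1 x≤ = proj₁ (cd _ x≥1 x≤)

  partner≤ : ∀ {x} → 1 ≤ x → x ≤ 2 * N → q x ≤ 2 * N
  partner≤ x≥1 x≤ = proj₁ (proj₂ (cd _ x≥1 x≤))

  partner≢ : ∀ {x} → 1 ≤ x → x ≤ 2 * N → q x ≢ x
  partner≢ x≥1 x≤ = proj₁ (proj₂ (proj₂ (cd _ x≥1 x≤)))

  involutive : ∀ {x} → 1 ≤ x → x ≤ 2 * N → q (q x) ≡ x
  involutive x≥1 x≤ = proj₂ (proj₂ (proj₂ (cd _ x≥1 x≤)))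

  partner-of : ∀ {x y} → 1 ≤ x → x ≤ 2 * N → q x ≡ y → x ≡ q y
  partner-of x≥1 x≤ qx≡y = trans (sym (involutive x≥1 x≤)) (cong q qx≡y)

-- Let {s,e} and {j,q j} be two different chords of a chord
-- diagram.  `swapStart q e s j` exchanges s and j, i.e. replaces these chords
-- by {j,e} and {s,q j}; the result is again a chord diagram.
module Reconnect {N : ℕ} {q : ℕ → ℕ} (cd : IsChordDiagram N q) {s e j : ℕ}
                 (s≥1 : 1 ≤ s) (s≤ : s ≤ 2 * N) (j≥1 : 1 ≤ j) (j≤ : j ≤ 2 * N)
                 (qs : q s ≡ e) (j≢s : j ≢ s) (j≢e : j ≢ e) where
  open ChordDiagram {N} cd

  qe : q e ≡ s
  qe = sym (partner-of s≥1 s≤ qs)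

  e≢s : e ≢ s
  e≢s = subst (_≢ s) qs (partner≢ s≥1 s≤)

  b≢s : q j ≢ s
  b≢s qj≡s = j≢e (trans (partner-of j≥1 j≤ qj≡s) qs)

  b≢e : q j ≢ e
  b≢e qj≡e = j≢s (trans (partner-of j≥1 j≤ qj≡e) qe)

  b≢j : q j ≢ j
  b≢j = partner≢ j≥1 j≤

  at-s : swapStart q e s j s ≡ q j
  at-s rewrite ≡ᵇ-refl s = refl

  at-j : swapStart q e s j j ≡ e
  at-j rewrite ≡ᵇ-≢ j≢s | ≡ᵇ-refl j = refl

  at-e : swapStart q e s j e ≡ j
  at-e rewrite ≡ᵇ-≢ e≢s | ≡ᵇ-≢ (≢-sym j≢e) | ≡ᵇ-refl e = refl

  at-b : swapStart q e s j (q j) ≡ s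
  at-b rewrite ≡ᵇ-≢ b≢s | ≡ᵇ-≢ b≢j | ≡ᵇ-≢ b≢e | ≡ᵇ-refl (q j) = refl

  elsewhere : ∀ x → x ≢ s → x ≢ j → x ≢ e → x ≢ q j → swapStart q e s j x ≡ q x
  elsewhere x x≢s x≢j x≢e x≢b rewrite ≡ᵇ-≢ x≢s | ≡ᵇ-≢ x≢j | ≡ᵇ-≢ x≢e | ≡ᵇ-≢ x≢b = refl

  partner-elsewhere : ∀ {x} → 1 ≤ x → x ≤ 2 * N →
                      x ≢ s → x ≢ j → x ≢ e → x ≢ q j →
                      q x ≢ s × q x ≢ j × q x ≢ e × q x ≢ q j
  partner-elsewhere x≥1 x≤ x≢s x≢j x≢e x≢b =
    (λ qx≡s → x≢e (trans (partner-of x≥1 x≤ qx≡s) qs)) ,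
    (λ qx≡j → x≢b (partner-of x≥1 x≤ qx≡j)) ,
    (λ qx≡e → x≢s (trans (partner-of x≥1 x≤ qx≡e) qe)) ,
    (λ qx≡b → x≢j (trans (partner-of x≥1 x≤ qx≡b) (involutive j≥1 j≤)))

  reconnected : IsChordDiagram N (swapStart q e s j)
  reconnected i i≥1 i≤ with i ≟ s | i ≟ j | i ≟ e | i ≟ q j
  ... | yes refl | _ | _ | _ rewrite at-s | at-b =
    partner≥1 j≥1 j≤ , partner≤ j≥1 j≤ , b≢s , refl
  ... | no _ | yes refl | _ | _ rewrite at-j | at-e =
    subst (1 ≤_) qs (partner≥1 s≥1 s≤) , subst (_≤ 2 * N) qs (partner≤ s≥1 s≤) , ≢-sym j≢e , refl
  ... | no _ | no _ | yes refl | _ rewrite at-e | at-j = j≥1 , j≤ , j≢e , refl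
  ... | no _ | no _ | no _ | yes refl rewrite at-b | at-s = s≥1 , s≤ , ≢-sym b≢s , refl
  ... | no i≢s | no i≢j | no i≢e | no i≢b
    with partner-elsewhere i≥1 i≤ i≢s i≢j i≢e i≢b
  ... | qi≢s , qi≢j , qi≢e , qi≢b
    rewrite elsewhere i i≢s i≢j i≢e i≢b | elsewhere (q i) qi≢s qi≢j qi≢e qi≢b =
    cd i i≥1 i≤

-- Deleting the points s < e and relabelling the others in order: the old point
-- behind a new label, and the new label of an old point.  These are literally
-- the relabellings used in the definition of β.
oldPoint : ℕ → ℕ → ℕ → ℕ
oldPoint s e x = if x <ᵇ s then x else if suc x <ᵇ e then suc x else x + 2

newLabel : ℕ → ℕ → ℕ → ℕ
newLabel s e x = if x <ᵇ s then x else if x <ᵇ e then x ∸ 1 else x ∸ 2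

gap-transfer : ∀ {a b x y δx δy} c L → δx + a ≡ x → δy + b ≡ y →
               δy ≤ c + δx → c + L + x ≤ y → L + a ≤ b
gap-transfer {a} {b} {x} {y} {δx} {δy} c L a↦x b↦y δy≤ gap =
  +-cancelˡ-≤ δy (L + a) b (begin
    δy + (L + a)      ≤⟨ +-monoˡ-≤ (L + a) δy≤ ⟩
    c + δx + (L + a)  ≡⟨ regroup c δx L a ⟩
    c + L + (δx + a)  ≡⟨ cong (c + L +_) a↦x ⟩
    c + L + x         ≤⟨ gap ⟩
    y                 ≡⟨ sym b↦y ⟩
    δy + b            ∎)
  where
  regroup : ∀ c d l a → c + d + (l + a) ≡ c + l + (d + a)
  regroup = solve-∀

module Deletion {s e : ℕ} (s≥1 : 1 ≤ s) (s<e : s < e) where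

  data Position (z : ℕ) : Set where
    before  : z < s → Position z
    between : s < z → z < e → Position z
    after   : e < z → Position z

  drop : ∀ {z} → Position z → ℕ
  drop (before _)    = 0
  drop (between _ _) = 1
  drop (after _)     = 2

  drop≤2 : ∀ {z} (p : Position z) → drop p ≤ 2
  drop≤2 (before _)    = z≤n
  drop≤2 (between _ _) = s≤s z≤n
  drop≤2 (after _)     = ≤-refl

  position : ∀ {z} → z ≢ s → z ≢ e → Position z
  position {z} z≢s z≢e with <-cmp z s | <-cmp z e
  ... | tri< z<s _ _ | _              = before z<s
  ... | tri≈ _ z≡s _ | _              = ⊥-elim (z≢s z≡s)
  ... | tri> _ _ s<z | tri< z<e _ _   = between s<z z<e
  ... | tri> _ _ _   | tri≈ _ z≡e _   = ⊥-elim (z≢e z≡e)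
  ... | tri> _ _ _   | tri> _ _ e<z   = after e<z

  survives : ∀ {z} → Position z → z ≢ s × z ≢ e
  survives (before z<s)      = <⇒≢ z<s , <⇒≢ (<-trans z<s s<e)
  survives (between s<z z<e) = >⇒≢ s<z , <⇒≢ z<e
  survives (after e<z)       = >⇒≢ (<-trans s<e e<z) , >⇒≢ e<z

  -- needed so that `x ∸ 2` in newLabel subtracts exactly two after e
  e≥2 : 2 ≤ e
  e≥2 = ≤-trans (s≤s s≥1) s<e

  newLabel-drop : ∀ {z} (p : Position z) → drop p + newLabel s e z ≡ z
  newLabel-drop (before z<s) rewrite <ᵇ-true z<s = refl
  newLabel-drop (between s<z z<e) rewrite <ᵇ-false (<⇒≤ s<z) | <ᵇ-true z<e =
    m+[n∸m]≡n (≤-trans s≥1 (<⇒≤ s<z))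
  newLabel-drop (after e<z) rewrite <ᵇ-false (<⇒≤ (<-trans s<e e<z)) | <ᵇ-false (<⇒≤ e<z) =
    m+[n∸m]≡n (≤-trans e≥2 (<⇒≤ e<z))

  oldPoint-before : ∀ {x} → x < s → oldPoint s e x ≡ x
  oldPoint-before x<s rewrite <ᵇ-true x<s = refl

  oldPoint-between : ∀ {x} → s ≤ x → suc x < e → oldPoint s e x ≡ suc x
  oldPoint-between s≤x sx<e rewrite <ᵇ-false s≤x | <ᵇ-true sx<e = refl

  oldPoint-after : ∀ {x} → e ≤ suc x → oldPoint s e x ≡ 2 + x
  oldPoint-after {x} e≤sx rewrite <ᵇ-false (s≤s⁻¹ (<-≤-trans s<e e≤sx)) | <ᵇ-false e≤sx =
    +-comm x 2

  oldPoint-position : ∀ x → Σ[ p ∈ Position (oldPoint s e x) ] oldPoint s e x ≡ drop p + x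
  oldPoint-position x with x <? s | suc x <? e
  ... | yes x<s | _ rewrite oldPoint-before x<s = before x<s , refl
  ... | no x≮s | yes sx<e rewrite oldPoint-between (≮⇒≥ x≮s) sx<e =
    between (s≤s (≮⇒≥ x≮s)) sx<e , refl
  ... | no _ | no sx≮e rewrite oldPoint-after (≮⇒≥ sx≮e) = after (s≤s (≮⇒≥ sx≮e)) , refl

  newLabel-oldPoint : ∀ x → newLabel s e (oldPoint s e x) ≡ x
  newLabel-oldPoint x with oldPoint-position x
  ... | p , x↦ = +-cancelˡ-≡ (drop p) _ x (trans (newLabel-drop p) x↦)

  oldPoint-newLabel : ∀ {y} → Position y → oldPoint s e (newLabel s e y) ≡ y
  oldPoint-newLabel p@(before y<s) =
    trans (cong (oldPoint s e) (newLabel-drop p)) (oldPoint-before y<s)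
  oldPoint-newLabel p@(between s<y y<e) =
    trans (oldPoint-between (s≤s⁻¹ (subst (s <_) (sym y↤) s<y)) (subst (_< e) (sym y↤) y<e)) y↤
    where y↤ = newLabel-drop p
  oldPoint-newLabel p@(after e<y) =
    trans (oldPoint-after (s≤s⁻¹ (subst (e <_) (sym y↤) e<y))) y↤
    where y↤ = newLabel-drop p

  oldPoint-range : ∀ {N x} → 1 ≤ x → x ≤ 2 * N →
                   1 ≤ oldPoint s e x × oldPoint s e x ≤ 2 * suc N
  oldPoint-range {N} {x} x≥1 x≤ with oldPoint-position x
  ... | p , x↦ rewrite x↦ =
    ≤-trans x≥1 (m≤n+m x (drop p)) ,
    subst (drop p + x ≤_) (sym (*-suc 2 N)) (+-mono-≤ (drop≤2 p) x≤)

  newLabel-range : ∀ {N y} → 1 ≤ y → y ≤ 2 * suc N → e ≤ 2 * suc N → Position y →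
                   1 ≤ newLabel s e y × newLabel s e y ≤ 2 * N
  newLabel-range {N} {y} y≥1 y≤ e≤ p =
    lower p , s≤s⁻¹ (s≤s⁻¹ (subst (2 + newLabel s e y ≤_) (*-suc 2 N) (upper p)))
    where
    lower : Position y → 1 ≤ newLabel s e y
    lower p@(before _)      = subst (1 ≤_) (sym (newLabel-drop p)) y≥1
    lower p@(between s<y _) = ≤-trans s≥1 (s≤s⁻¹ (subst (s <_) (sym (newLabel-drop p)) s<y))
    lower p@(after e<y)     =
      ≤-trans s≥1 (s≤s⁻¹ (≤-trans s<e (s≤s⁻¹ (subst (e <_) (sym (newLabel-drop p)) e<y))))
    upper : Position y → 2 + newLabel s e y ≤ 2 * suc N
    upper p@(before y<s)    = ≤-trans (s≤s (subst (_< s) (sym (newLabel-drop p)) y<s)) (≤-trans s<e e≤)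
    upper p@(between _ y<e) = ≤-trans (subst (_< e) (sym (newLabel-drop p)) y<e) e≤
    upper p@(after _)       = subst (_≤ 2 * suc N) (sym (newLabel-drop p)) y≤

  image-gap : ∀ {L x y} → x < y → (px : Position x) (py : Position y) →
              suc L + x ≤ y → (x < s → e < y → 2 + L + x ≤ y) →
              L + newLabel s e x ≤ newLabel s e y
  image-gap {L} _ px@(before _) py@(before _) long _ =
    gap-transfer 1 L (newLabel-drop px) (newLabel-drop py) z≤n long
  image-gap {L} _ px@(before _) py@(between _ _) long _ =
    gap-transfer 1 L (newLabel-drop px) (newLabel-drop py) ≤-refl long
  image-gap {L} _ px@(before x<s) py@(after e<y) _ straddle =
    gap-transfer 2 L (newLabel-drop px) (newLabel-drop py) ≤-refl (straddle x<s e<y)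
  image-gap {L} _ px@(between _ _) py@(between _ _) long _ =
    gap-transfer 1 L (newLabel-drop px) (newLabel-drop py) (n≤1+n 1) long
  image-gap {L} _ px@(between _ _) py@(after _) long _ =
    gap-transfer 1 L (newLabel-drop px) (newLabel-drop py) ≤-refl long
  image-gap {L} _ px@(after _) py@(after _) long _ =
    gap-transfer 1 L (newLabel-drop px) (newLabel-drop py) (n≤1+n 2) long
  image-gap x<y (between s<x _) (before y<s) _ _ = ⊥-elim (<-asym x<y (<-trans y<s s<x))
  image-gap x<y (after e<x) (before y<s) _ _ =
    ⊥-elim (<-asym x<y (<-trans y<s (<-trans s<e e<x)))
  image-gap x<y (after e<x) (between _ y<e) _ _ = ⊥-elim (<-asym x<y (<-trans y<e e<x))

  module Deleted {N : ℕ} {q : ℕ → ℕ} (cd : IsChordDiagram (suc N) q)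
                 (qs : q s ≡ e) (e≤ : e ≤ 2 * suc N) where
    open ChordDiagram {suc N} cd

    reduced : ℕ → ℕ
    reduced i = newLabel s e (q (oldPoint s e i))

    s≤ : s ≤ 2 * suc N
    s≤ = <⇒≤ (<-≤-trans s<e e≤)

    -- the partner of a surviving point survives, as {s,e} is a chord
    partner-survives : ∀ {x} → 1 ≤ x → x ≤ 2 * suc N → Position x → Position (q x)
    partner-survives x≥1 x≤ p = position
      (λ qx≡s → proj₂ (survives p) (trans (partner-of x≥1 x≤ qx≡s) qs))
      (λ qx≡e → proj₁ (survives p)
        (trans (partner-of x≥1 x≤ qx≡e) (sym (partner-of s≥1 s≤ qs))))

    diagram : IsChordDiagram N reduced
    diagram i i≥1 i≤ =
      proj₁ (newLabel-range y≥1 y≤ e≤ py) , proj₂ (newLabel-range y≥1 y≤ e≤ py) ,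
      (λ gy≡i → partner≢ x≥1 x≤ (trans (sym (oldPoint-newLabel py)) (cong (oldPoint s e) gy≡i))) ,
      back
      where
      x = oldPoint s e i
      x≥1 = proj₁ (oldPoint-range {N} i≥1 i≤)
      x≤ = proj₂ (oldPoint-range {N} i≥1 i≤)
      y = q x
      y≥1 = partner≥1 x≥1 x≤
      y≤ = partner≤ x≥1 x≤
      py = partner-survives x≥1 x≤ (proj₁ (oldPoint-position i))
      back : reduced (newLabel s e y) ≡ i
      back = begin-equality
        newLabel s e (q (oldPoint s e (newLabel s e y))) ≡⟨ cong (newLabel s e ∘ q) (oldPoint-newLabel py) ⟩
        newLabel s e (q y)                               ≡⟨ cong (newLabel s e) (involutive x≥1 x≤) ⟩
        newLabel s e x                                   ≡⟨ newLabel-oldPoint i ⟩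
        i                                                ∎

    chord-gap : ∀ {L a} →
      (∀ x → 1 ≤ x → x ≤ 2 * suc N → x ≢ s → x < q x → suc L + x ≤ q x) →
      (∀ x → 1 ≤ x → x < s → x < q x → e < q x → 2 + L + x ≤ q x) →
      1 ≤ a → a ≤ 2 * suc N → Position a → a < q a →
      L + newLabel s e a ≤ newLabel s e (q a)
    chord-gap long straddle a≥1 a≤ pa a<qa =
      image-gap a<qa pa (partner-survives a≥1 a≤ pa)
        (long _ a≥1 a≤ (proj₁ (survives pa)) a<qa)
        (λ a<s e<qa → straddle _ a≥1 a<s a<qa e<qa)

    lengths : ∀ {L} →
      (∀ x → 1 ≤ x → x ≤ 2 * suc N → x ≢ s → x < q x → suc L + x ≤ q x) →
      (∀ x → 1 ≤ x → x < s → x < q x → e < q x → 2 + L + x ≤ q x) →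
      AllLengthsAtLeast N L reduced
    lengths {L} long straddle i i≥1 i≤ i<ri = by-order (<-cmp x y)
      where
      x = oldPoint s e i
      x≥1 = proj₁ (oldPoint-range {N} i≥1 i≤)
      x≤ = proj₂ (oldPoint-range {N} i≥1 i≤)
      px = proj₁ (oldPoint-position i)
      y = q x
      y↦x : q y ≡ x
      y↦x = involutive x≥1 x≤
      by-order : Tri (x < y) (x ≡ y) (y < x) → L + i ≤ reduced i
      by-order (tri< x<y _ _) =
        subst (λ z → L + z ≤ reduced i) (newLabel-oldPoint i) (chord-gap long straddle x≥1 x≤ px x<y)
      by-order (tri≈ _ x≡y _) = ⊥-elim (partner≢ x≥1 x≤ (sym x≡y))
      by-order (tri> _ _ y<x) = ⊥-elim (<⇒≱ i<ri (≤-trans (m≤n+m _ L) L+gy≤i))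
        where
        L+gy≤i : L + newLabel s e y ≤ i
        L+gy≤i = subst (L + newLabel s e y ≤_) (trans (cong (newLabel s e) y↦x) (newLabel-oldPoint i))
                   (chord-gap long straddle (partner≥1 x≥1 x≤) (partner≤ x≥1 x≤)
                     (partner-survives x≥1 x≤ px) (subst (y <_) (sym y↦x) y<x))

record Window (n k e : ℕ) : Set where
  field
    e-after-M : e ≡ suc (2 * n ∸ k)
    k<e       : k < e
    e≤2n      : e ≤ 2 * n
    2n<k+e    : 2 * n < k + e   -- no chord of length ≥ k starts at or after e
    e≤k+k     : e ≤ k + k       -- the chord through e starts in {1,…,k}

  e≥1 : 1 ≤ e
  e≥1 = ≤-trans (s≤s z≤n) k<e

window-from : ∀ {n k t} → 1 ≤ k → 2 * n ≡ t + k → k ≤ t → t < k + k → Window n k (suc t)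
window-from {n} {k} {t} k≥1 2n≡ k≤t t<2k = record
  { e-after-M = cong suc (sym (trans (cong (_∸ k) 2n≡) (m+n∸n≡m t k)))
  ; k<e       = s≤s k≤t
  ; e≤2n      = subst (suc t ≤_) (sym 2n≡) (subst (_≤ t + k) (+-comm t 1) (+-monoʳ-≤ t k≥1))
  ; 2n<k+e    = subst₂ _<_ (sym 2n≡) (trans (cong suc (+-comm t k)) (sym (+-suc k t))) (n<1+n (t + k))
  ; e≤k+k     = t<2k
  }

-- With d = n - k, so 2n - k = 2d + k, the hypothesis n > 3d says 2d < k.
window : ∀ n k → 1 ≤ k → k ≤ n → 3 * (n ∸ k) < n → Window n k (2 * n ∸ k + 1)
window n k k≥1 k≤n 3d<n =
  subst (Window n k) (sym e≡) (window-from k≥1 2n≡ (m≤n+m k (2 * d)) (+-monoˡ-≤ k 2d<k))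
  where
  d = n ∸ k
  d+k≡n : d + k ≡ n
  d+k≡n = m∸n+n≡m k≤n
  2d<k : 2 * d < k
  2d<k = +-cancelˡ-< d (2 * d) k (subst (3 * d <_) (sym d+k≡n) 3d<n)
  double : ∀ d k → 2 * (d + k) ≡ 2 * d + k + k
  double = solve-∀
  2n≡ : 2 * n ≡ 2 * d + k + k
  2n≡ = trans (cong (2 *_) (sym d+k≡n)) (double d k)
  e≡ : 2 * n ∸ k + 1 ≡ suc (2 * d + k)
  e≡ = trans (+-comm (2 * n ∸ k) 1) (cong suc (trans (cong (_∸ k) 2n≡) (m+n∸n≡m (2 * d + k) k)))

module Exchange {n k e : ℕ} (W : Window n k e) where
  open Window W

  Outside : ℕ → Set
  Outside x = x ≤ k ⊎ e ≤ x

  outside-sound : ∀ x → T (not (inM n k x)) → Outside x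
  outside-sound x x∉M with k <ᵇ x in k<ᵇx
  ... | false = inj₁ (≮⇒≥ (λ k<x → subst T k<ᵇx (<⇒<ᵇ k<x)))
  ... | true with x ≤ᵇ 2 * n ∸ k in x≤ᵇ
  ...   | false = inj₂ (subst (_≤ x) (sym e-after-M) (≰⇒> (λ x≤ → subst T x≤ᵇ (≤⇒≤ᵇ x≤))))
  ...   | true  = ⊥-elim x∉M

  outside-complete : ∀ {x} → Outside x → T (not (inM n k x))
  outside-complete (inj₁ x≤k) rewrite <ᵇ-false x≤k = tt
  outside-complete {x} (inj₂ e≤x) with k <ᵇ x
  ... | false = tt
  ... | true rewrite ≤ᵇ-false (subst (_≤ x) e-after-M e≤x) = tt

  record SStart (q : ℕ → ℕ) (j : ℕ) : Set where
    field
      lower     : 1 ≤ j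
      upper     : j ≤ 2 * n
      starts    : j < q j
      start-out : Outside j
      end-out   : Outside (q j)

  sstart-sound : ∀ {q j} → T (isSStart n k q j) → SStart q j
  sstart-sound {q} {j} h =
    let (t₁ , h₁) = to T-∧ h
        (t₂ , h₂) = to T-∧ h₁
        (t₃ , h₃) = to T-∧ h₂
        (t₄ , t₅) = to T-∧ h₃
    in record { lower = ≤ᵇ⇒≤ 1 j t₁ ; upper = ≤ᵇ⇒≤ j (2 * n) t₂ ; starts = <ᵇ⇒< j (q j) t₃
              ; start-out = outside-sound j t₄ ; end-out = outside-sound (q j) t₅ }

  sstart-complete : ∀ {q j} → SStart q j → T (isSStart n k q j)
  sstart-complete J = from T-∧ (≤⇒≤ᵇ lower , from T-∧ (≤⇒≤ᵇ upper , from T-∧ (<⇒<ᵇ starts ,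
                        from T-∧ (outside-complete start-out , outside-complete end-out))))
    where open SStart J

  record Invariant (q : ℕ → ℕ) (s : ℕ) : Set where
    field
      diagram    : IsChordDiagram n q
      moving     : q e ≡ s
      start≥1    : 1 ≤ s
      start≤k    : s ≤ k
      long       : ∀ i → 1 ≤ i → i ≤ 2 * n → i ≢ s → i < q i → k + i ≤ q i
      straddling : ∀ i → 1 ≤ i → i < s → i < q i → e < q i → suc k + i ≤ q i

    s<e : s < e
    s<e = ≤-<-trans start≤k k<e

    moving-back : q s ≡ e
    moving-back = subst (λ z → q z ≡ e) moving (ChordDiagram.involutive {n} diagram e≥1 e≤2n)

  initial : ∀ {C} → IsChordDiagram n C → AllLengthsAtLeast n k C → Invariant C (C e)
  initial {C} cd long = record
    { diagram = cd ; moving = refl ; start≥1 = partner≥1 e≥1 e≤2n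
    ; start≤k = +-cancelˡ-≤ k _ _ (≤-trans c-long e≤k+k)
    ; long = λ i i≥1 i≤ _ → long i i≥1 i≤
    ; straddling = λ i _ i<s _ e<Ci → ≤-trans (+-monoʳ-< k i<s) (≤-trans c-long (<⇒≤ e<Ci)) }
    where
    open ChordDiagram {n} cd
    Ce<e : C e < e
    Ce<e with <-cmp (C e) e
    ... | tri< Ce<e _ _ = Ce<e
    ... | tri≈ _ Ce≡e _ = ⊥-elim (partner≢ e≥1 e≤2n Ce≡e)
    ... | tri> _ _ e<Ce = ⊥-elim (<⇒≱ 2n<k+e (≤-trans (long e e≥1 e≤2n e<Ce) (partner≤ e≥1 e≤2n)))
    c-long : k + C e ≤ e
    c-long = subst (k + C e ≤_) (involutive e≥1 e≤2n)
      (long (C e) (partner≥1 e≥1 e≤2n) (partner≤ e≥1 e≤2n)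
        (subst (C e <_) (sym (involutive e≥1 e≤2n)) Ce<e))

  -- The chord of S met next starts in {1,…,k}: being long, it cannot start at
  -- or after e.
  next-start≤k : ∀ {q s j} → Invariant q s → SStart q j → j ≢ s → j ≤ k
  next-start≤k {q} {s} {j} I J j≢s with SStart.start-out J
  ... | inj₁ j≤k = j≤k
  ... | inj₂ e≤j = ⊥-elim (<⇒≱ 2n<k+e (begin
      k + e  ≤⟨ +-monoʳ-≤ k e≤j ⟩
      k + j  ≤⟨ long j lower upper j≢s starts ⟩
      q j    ≤⟨ ChordDiagram.partner≤ {n} diagram lower upper ⟩
      2 * n  ∎))
    where
    open Invariant I
    open SStart J

  -- The chords passed over by the moving
  -- start are not chords of S (by minimality of j), so those among them
  -- straddling the new moving chord already straddled the old one.
  step : ∀ {q s j} → Invariant q s → SStart q j → s < j →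
         (∀ x → s < x → x < j → ¬ T (isSStart n k q x)) →
         Invariant (swapStart q e s j) j
  step {q} {s} {j} I J s<j first = record
    { diagram = reconnected ; moving = at-e ; start≥1 = lower ; start≤k = j≤k
    ; long = long′ ; straddling = straddling′ }
    where
    open Invariant I
    open SStart J
    j≢s : j ≢ s
    j≢s = >⇒≢ s<j
    j≤k : j ≤ k
    j≤k = next-start≤k I J j≢s
    j<e : j < e
    j<e = ≤-<-trans j≤k k<e
    open Reconnect {n} diagram start≥1 (<⇒≤ (<-≤-trans s<e e≤2n)) lower upper moving-back j≢s (<⇒≢ j<e)
    -- the chord of S passed over has length ≥ k, so {s, q j} is longer still
    new-chord : k + s < q j
    new-chord = <-≤-trans (+-monoʳ-< k s<j) (long j lower upper j≢s starts)

    long′ : ∀ i → 1 ≤ i → i ≤ 2 * n → i ≢ j → i < swapStart q e s j i →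
            k + i ≤ swapStart q e s j i
    long′ i i≥1 i≤ i≢j i<sw with i ≟ s | i ≟ e | i ≟ q j
    ... | yes refl | _ | _ rewrite at-s = <⇒≤ new-chord
    ... | no _ | yes refl | _ rewrite at-e = ⊥-elim (<-asym i<sw j<e)
    ... | no _ | no _ | yes refl rewrite at-b = ⊥-elim (<-asym i<sw (<-trans s<j starts))
    ... | no i≢s | no i≢e | no i≢b rewrite elsewhere i i≢s i≢j i≢e i≢b = long i i≥1 i≤ i≢s i<sw

    straddling′ : ∀ i → 1 ≤ i → i < j → i < swapStart q e s j i → e < swapStart q e s j i →
                  suc k + i ≤ swapStart q e s j i
    straddling′ i i≥1 i<j i<sw e<sw with i ≟ s | i ≟ e | i ≟ q j
    ... | yes refl | _ | _ rewrite at-s = new-chord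
    ... | no _ | yes refl | _ = ⊥-elim (<-asym i<j j<e)
    ... | no _ | no _ | yes refl = ⊥-elim (<-asym i<j starts)
    ... | no i≢s | no i≢e | no i≢b rewrite elsewhere i i≢s (<⇒≢ i<j) i≢e i≢b with <-cmp i s
    ...   | tri< i<s _ _ = straddling i i≥1 i<s i<sw e<sw
    ...   | tri≈ _ i≡s _ = ⊥-elim (i≢s i≡s)
    ...   | tri> _ _ s<i = ⊥-elim (first i s<i i<j (sstart-complete {q} {i} record
            { lower = i≥1 ; upper = ≤-trans (<⇒≤ i<j) upper ; starts = i<sw
            ; start-out = inj₁ (≤-trans (<⇒≤ i<j) j≤k) ; end-out = inj₂ (<⇒≤ e<sw) }))

  iterate : ∀ fuel q s → Invariant q s →
            Invariant (DiagPt.diag (exchangeLoop n k e fuel q s)) (DiagPt.pt (exchangeLoop n k e fuel q s))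
  iterate zero q s I = I
  iterate (suc fuel) q s I with search (2 * n) (isSStart n k q) (suc s) in found
  ... | nothing = I
  ... | just j with search-first (2 * n) (isSStart n k q) (suc s) j found
  ...   | Sj , s<j , first = iterate fuel (swapStart q e s j) j (step I (sstart-sound Sj) s<j first)

-- The theorem: run the loop from C, then delete the moving chord.  As n, k ≥ 1
-- we write n = N + 1 and k = L + 1, so that n - 1 = N and k - 1 = L.
lemma5 : (n k : ℕ) → 1 ≤ n → 1 ≤ k → k ≤ n → 3 * (n ∸ k) < n →
    (C : ℕ → ℕ) → IsChordDiagram n C → AllLengthsAtLeast n k C →
    IsChordDiagram (n ∸ 1) (β n k C) × AllLengthsAtLeast (n ∸ 1) (k ∸ 1) (β n k C)
lemma5 (suc N) (suc L) _ k≥1 k≤n 3d<n C cd lengths≥k =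
  Reduced.diagram , Reduced.lengths long straddling
  where
  W : Window (suc N) (suc L) (2 * suc N ∸ suc L + 1)
  W = window (suc N) (suc L) k≥1 k≤n 3d<n
  open Window W
  open Exchange W
  open Invariant (iterate (2 * suc N) C (C (2 * suc N ∸ suc L + 1)) (initial cd lengths≥k))
  module Reduced = Deletion.Deleted start≥1 s<e diagram moving-back e≤2n
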